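{- Let $n\geq2$. If $\sigma\in\tilde{\mathfrak S}_{n+1}$ and $\omega\in\mathfrak S_n$ satisfy $\mathrm{code}_3(\sigma)=\widehat{\mathrm{code}}(\omega)$, then $D_3(\sigma)=\hat D(\omega)$.
   Context: $\tilde{\mathfrak S}_{n+1}$ is the set of permutations of $[n+1]$ with first entry $1$. For $\sigma\in\mathfrak S_{m}$: $D_3(\sigma)$ is the set of $i\in[m-2]$ such that $\sigma_i\sigma_{i+1}\sigma_{i+2}$ (standardized) is an odd permutation in $\mathfrak S_3$; for $i\in[m-2]$, $c^3_i(\sigma)$ is the number of $j>i+1$ such that $\sigma_i\sigma_{i+1}\sigma_j$ is odd, and $\mathrm{code}_3(\sigma)=(c^3_1,\dots,c^3_{m-2})$. For $\omega\in\mathfrak S_n$: $\hat D(\omega)$ is the set of $i\in[n-1]$ such that either $i$ is odd and $\omega_i>\omega_{i+1}$, or $i$ is even and $\omega_i<\omega_{i+1}$; $\hat c_i(\omega)$ is the number of $j>i$ with $\omega_i>\omega_j$ if $i$ is odd and with $\omega_i<\omega_j$ if $i$ is even, and $\widehat{\mathrm{code}}(\omega)=(\hat c_1,\dots,\hat c_{n-1})$. -}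

module Defs where

open import Data.Nat using (ℕ; zero; suc; _+_; _<_; _<ᵇ_; _∸_)
open import Data.Bool using (Bool; true; false; if_then_else_; not; _xor_)
open import Data.Fin using (Fin; toℕ; fromℕ<; zero; suc)
open import Data.Fin.Permutation using (Permutation′; _⟨$⟩ʳ_)
open import Data.Nat.Properties using (_<?_)
open import Relation.Nullary using (yes; no)
open import Relation.Binary.PropositionalEquality using (_≡_)

-- A permutation of [m] is an element of Permutation′ m (a bijection Fin m ↔ Fin m).
-- Its one-line notation: position p (0-based) carries value σ ⟨$⟩ʳ p (0-based).

-- value at 0-based position p (as a natural number); 0 outside range (never used there)
val : ∀ {m} → Permutation′ m → ℕ → ℕ
val {m} σ p with p <? m
... | yes p<m = toℕ (σ ⟨$⟩ʳ fromℕ< p<m)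
... | no _ = 0

countFrom : (ℕ → Bool) → ℕ → ℕ → ℕ
countFrom P a zero = 0
countFrom P a (suc len) = (if P a then 1 else 0) + countFrom P (suc a) len

-- a word a b c of distinct values standardizes to an odd permutation of S_3
-- iff its number of inversions is odd
oddPattern : ℕ → ℕ → ℕ → Bool
oddPattern a b c = (b <ᵇ a) xor ((c <ᵇ a) xor (c <ᵇ b))

isEvenℕ : ℕ → Bool
isEvenℕ zero = true
isEvenℕ (suc n) = not (isEvenℕ n)

-- Paper's 1-based index i corresponds to 0-based index p = i - 1.

D₃ : ∀ {m} → Permutation′ m → ℕ → Bool
D₃ σ p = oddPattern (val σ p) (val σ (suc p)) (val σ (suc (suc p)))

code₃ : ∀ {m} → Permutation′ m → ℕ → ℕ
code₃ {m} σ p =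
  countFrom (λ q → oddPattern (val σ p) (val σ (suc p)) (val σ q))
            (suc (suc p)) (m ∸ suc (suc p))

-- paper's i is odd  iff  0-based p = i - 1 is even
-- i ∈ D̂(ω)
Dhat : ∀ {n} → Permutation′ n → ℕ → Bool
Dhat ω p = if isEvenℕ p then val ω (suc p) <ᵇ val ω p
                        else val ω p <ᵇ val ω (suc p)

codeHat : ∀ {n} → Permutation′ n → ℕ → ℕ
codeHat {n} ω p =
  countFrom (λ q → if isEvenℕ p then val ω q <ᵇ val ω p else val ω p <ᵇ val ω q)
            (suc p) (n ∸ suc p)

FirstIsOne : ∀ {m} → Permutation′ (suc m) → Set
FirstIsOne σ = σ ⟨$⟩ʳ zero ≡ zero

module Submission where

-- Fix a position p (0-based) with p < n-1 and let M = n-p-2 be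
-- the number of letters strictly after the window p, p+1, p+2 of σ (resp.
-- after p+1 of ω).  Write D for "p is a descent".  On both sides,
--   code(p) + code(p+1) = [D] + (#{q : P q} + #{q : Q q})        (q ranges over M places)
-- for two predicates P, Q that are "separated by D": if D holds, every q
-- satisfies P or Q; if D fails, no q satisfies both.  Hence the sum is
-- ≥ 1 + M when D holds and ≤ M when it fails, so D is determined by
-- code(p) + code(p+1) and M alone.  Equal codes therefore force equal
-- descent sets.

open import Defs
open import Data.Nat using (ℕ; zero; suc; _≤_; _<_; _∸_; _+_; _<ᵇ_; z≤n; s≤s)
open import Data.Nat.Properties
  using (≤-refl; +-mono-≤; <⇒≱; <-trans; <-≤-trans; ≮⇒≥; m≤n⇒m∸n≡0; +-∸-assoc; +-assoc; <ᵇ-reflects-<; _<?_; +-commutativeSemigroup)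
open import Algebra.Properties.CommutativeSemigroup +-commutativeSemigroup using (interchange)
open import Data.Bool using (Bool; true; false; if_then_else_; not; _xor_; _∨_; _∧_; T)
open import Data.Bool.Properties using (∨-comm; ∧-comm)
open import Data.Fin.Permutation using (Permutation′)
open import Data.Unit using (tt)
open import Data.Empty using (⊥-elim)
open import Relation.Nullary using (¬_; yes; no)
open import Relation.Nullary.Reflects using (ofʸ; ofⁿ)
open import Relation.Binary.PropositionalEquality using (_≡_; refl; sym; trans; cong; cong₂; subst)

indicator : Bool → ℕ
indicator b = if b then 1 else 0

Bound : Bool → ℕ → ℕ → Set
Bound true  m s = m ≤ s
Bound false m s = s ≤ m

bound-refl : ∀ D m → Bound D m m
bound-refl true  m = ≤-refl
bound-refl false m = ≤-refl

bound-+ : ∀ {D m m′ s s′} → Bound D m s → Bound D m′ s′ → Bound D (m + m′) (s + s′)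
bound-+ {true}  = +-mono-≤
bound-+ {false} = +-mono-≤

-- The key uniqueness: s ≥ 1 + M and s ≤ M are incompatible, so a Boolean D
-- with Bound D ([D] + M) s is determined by M and s.
bound-unique : ∀ {D₁ D₂} M s → Bound D₁ (indicator D₁ + M) s → Bound D₂ (indicator D₂ + M) s → D₁ ≡ D₂
bound-unique {true}  {true}  M s _ _ = refl
bound-unique {false} {false} M s _ _ = refl
bound-unique {true}  {false} M s M<s s≤M = ⊥-elim (<⇒≱ M<s s≤M)
bound-unique {false} {true}  M s s≤M M<s = ⊥-elim (<⇒≱ M<s s≤M)

separates : Bool → Bool → Bool → Bool
separates true  x y = x ∨ y
separates false x y = not (x ∧ y)

separates-swap : ∀ D x y → separates D x y ≡ separates D y x
separates-swap true  x y = ∨-comm x y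
separates-swap false x y = cong not (∧-comm x y)

separates-bound : ∀ D x y → T (separates D x y) → Bound D 1 (indicator x + indicator y)
separates-bound true  true  y     _ = s≤s z≤n
separates-bound true  false true  _ = ≤-refl
separates-bound false true  false _ = ≤-refl
separates-bound false false true  _ = ≤-refl
separates-bound false false false _ = z≤n

count-bound : ∀ {D} (P Q : ℕ → Bool) a M → (∀ q → T (separates D (P q) (Q q))) →
  Bound D M (countFrom P a M + countFrom Q a M)
count-bound {D} P Q a zero    sep = bound-refl D 0
count-bound {D} P Q a (suc M) sep =
  subst (Bound D (suc M))
    (sym (interchange (indicator (P a)) (countFrom P (suc a) M) (indicator (Q a)) (countFrom Q (suc a) M)))
    (bound-+ (separates-bound D (P a) (Q a) (sep a)) (count-bound P Q (suc a) M sep))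

-- A window of length 1 + M whose first test D = P a separates P and Q:
-- the code at the window plus the code of the next tail determine D.
window-bound : ∀ (P Q : ℕ → Bool) a {L} M → L ≡ suc M → (∀ q → T (separates (P a) (P q) (Q q))) →
  Bound (P a) (indicator (P a) + M) (countFrom P a L + countFrom Q (suc a) M)
window-bound P Q a M refl sep =
  subst (Bound (P a) (indicator (P a) + M))
    (sym (+-assoc (indicator (P a)) (countFrom P (suc a) M) (countFrom Q (suc a) M)))
    (bound-+ (bound-refl (P a) (indicator (P a))) (count-bound P Q (suc a) M sep))

-- Separation for ω: if v < u then every w has w < u or v < w; if not, no w
-- has both (that would give v < w < u).
<-separates : ∀ u v w → T (separates (v <ᵇ u) (w <ᵇ u) (v <ᵇ w))
<-separates u v w with v <ᵇ u | <ᵇ-reflects-< v u | w <ᵇ u | <ᵇ-reflects-< w u | v <ᵇ w | <ᵇ-reflects-< v w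
... | true  | _       | true  | _       | _     | _       = tt
... | true  | _       | false | _       | true  | _       = tt
... | true  | ofʸ v<u | false | ofⁿ w≮u | false | ofⁿ v≮w = v≮w (<-≤-trans v<u (≮⇒≥ w≮u))
... | false | _       | false | _       | _     | _       = tt
... | false | _       | true  | _       | false | _       = tt
... | false | ofⁿ v≮u | true  | ofʸ w<u | true  | ofʸ v<w = v≮u (<-trans v<w w<u)

-- The comparison used by D̂ and ĉ at a position of parity e (e = "0-based
-- position is even"): there x is compared downwards, otherwise upwards.
before : Bool → ℕ → ℕ → Bool
before e x y = if e then y <ᵇ x else x <ᵇ y

before-separates : ∀ e u v w → T (separates (before e u v) (before e u w) (before (not e) v w))
before-separates true  u v w = <-separates u v w
before-separates false u v w = subst T (separates-swap (u <ᵇ v) (w <ᵇ v) (u <ᵇ w)) (<-separates v u w)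

-- Exhaustive evaluation of Boolean formulas: a formula in k variables holds
-- for all arguments as soon as it evaluates to true on all 2^k of them.
Bools : ℕ → Set
Bools zero    = Bool
Bools (suc k) = Bool → Bools k

every : ∀ k → Bools k → Bool
every zero    b = b
every (suc k) f = every k (f false) ∧ every k (f true)

Holds : ∀ k → Bools k → Set
Holds zero    b = T b
Holds (suc k) f = ∀ x → Holds k (f x)

every-sound : ∀ k (f : Bools k) → T (every k f) → Holds k f
every-sound zero    b t = t
every-sound (suc k) f t with every k (f false) | every-sound k (f false) | every k (f true) | every-sound k (f true)
... | true | sound-false | true | sound-true = λ { false → sound-false t ; true → sound-true t }

_implies_ : Bool → Bool → Bool
true  implies y = y
false implies _ = true
infixr 4 _implies_

modus-ponens : ∀ {x y} → T (x implies y) → T x → T y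
modus-ponens {true} t _ = t

-- Bits (b < a, c < a, c < b) can arise from three numbers only if they
-- respect transitivity and comparability of the order.
consistent : Bool → Bool → Bool → Bool
consistent x y z = ((x ∧ z) implies y) ∧ (y implies (x ∨ z))

<ᵇ-consistent : ∀ a b c → T (consistent (b <ᵇ a) (c <ᵇ a) (c <ᵇ b))
<ᵇ-consistent a b c with b <ᵇ a | <ᵇ-reflects-< b a | c <ᵇ a | <ᵇ-reflects-< c a | c <ᵇ b | <ᵇ-reflects-< c b
... | true  | ofʸ b<a | false | ofⁿ c≮a | true  | ofʸ c<b = c≮a (<-trans c<b b<a)
... | false | ofⁿ b≮a | true  | ofʸ c<a | false | ofⁿ c≮b = c≮b (<-≤-trans c<a (≮⇒≥ b≮a))
... | true  | _       | true  | _       | true  | _       = tt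
... | true  | _       | true  | _       | false | _       = tt
... | true  | _       | false | _       | false | _       = tt
... | false | _       | true  | _       | true  | _       = tt
... | false | _       | false | _       | true  | _       = tt
... | false | _       | false | _       | false | _       = tt

-- The separation property of odd patterns, as a statement about the six
-- comparison bits x₁..x₆ = (b<a, c<a, c<b, d<a, d<b, d<c) of four numbers.
odd-separation-law : Bools 6
odd-separation-law x₁ x₂ x₃ x₄ x₅ x₆ =
  consistent x₁ x₂ x₃ implies consistent x₁ x₄ x₅ implies consistent x₂ x₄ x₆ implies consistent x₃ x₅ x₆ implies
  separates (x₁ xor (x₂ xor x₃)) (x₁ xor (x₄ xor x₅)) (x₃ xor (x₅ xor x₆))

odd-separates : ∀ a b c d → T (separates (oddPattern a b c) (oddPattern a b d) (oddPattern b c d))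
odd-separates a b c d =
  modus-ponens (modus-ponens (modus-ponens (modus-ponens
    (every-sound 6 odd-separation-law tt (b <ᵇ a) (c <ᵇ a) (c <ᵇ b) (d <ᵇ a) (d <ᵇ b) (d <ᵇ c))
    (<ᵇ-consistent a b c)) (<ᵇ-consistent a b d)) (<ᵇ-consistent a c d)) (<ᵇ-consistent b c d)

-- Characterisation of D₃ by code₃ (σ of length n+1, so that its tails match ω's).
D₃-bound : ∀ {n} (σ : Permutation′ (suc n)) p → n ∸ suc p ≡ suc (n ∸ suc (suc p)) →
  Bound (D₃ σ p) (indicator (D₃ σ p) + (n ∸ suc (suc p))) (code₃ σ p + code₃ σ (suc p))
D₃-bound {n} σ p window =
  window-bound (λ q → oddPattern (val σ p) (val σ (suc p)) (val σ q))
               (λ q → oddPattern (val σ (suc p)) (val σ (suc (suc p))) (val σ q))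
               (suc (suc p)) (n ∸ suc (suc p)) window
               (λ q → odd-separates (val σ p) (val σ (suc p)) (val σ (suc (suc p))) (val σ q))

Dhat-bound : ∀ {n} (ω : Permutation′ n) p → n ∸ suc p ≡ suc (n ∸ suc (suc p)) →
  Bound (Dhat ω p) (indicator (Dhat ω p) + (n ∸ suc (suc p))) (codeHat ω p + codeHat ω (suc p))
Dhat-bound {n} ω p window =
  window-bound (λ q → before (isEvenℕ p) (val ω p) (val ω q))
               (λ q → before (not (isEvenℕ p)) (val ω (suc p)) (val ω q))
               (suc p) (n ∸ suc (suc p)) window
               (λ q → before-separates (isEvenℕ p) (val ω p) (val ω (suc p)) (val ω q))

window-length : ∀ n p → p < n ∸ 1 → n ∸ suc p ≡ suc (n ∸ suc (suc p))
window-length (suc n) p p<n = +-∸-assoc 1 (s≤s p<n)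

beyond-end : ∀ n q → ¬ (q < n ∸ 1) → n ∸ suc q ≡ 0
beyond-end zero    q _   = refl
beyond-end (suc n) q q≮n = m≤n⇒m∸n≡0 (≮⇒≥ q≮n)

countFrom-empty : ∀ (P : ℕ → Bool) a {L} → L ≡ 0 → countFrom P a L ≡ 0
countFrom-empty P a refl = refl

proposition3p8 : (n : ℕ) → 2 ≤ n →
    (σ : Permutation′ (suc n)) → FirstIsOne σ → (ω : Permutation′ n) →
    ((p : ℕ) → p < n ∸ 1 → code₃ σ p ≡ codeHat ω p) →
    ((p : ℕ) → p < n ∸ 1 → D₃ σ p ≡ Dhat ω p)
proposition3p8 n _ σ _ ω codes p p<n =
  bound-unique (n ∸ suc (suc p)) (code₃ σ p + code₃ σ (suc p))
    (D₃-bound σ p window)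
    (subst (Bound (Dhat ω p) _) (sym (cong₂ _+_ (codes p p<n) next-codes)) (Dhat-bound ω p window))
  where
  window : n ∸ suc p ≡ suc (n ∸ suc (suc p))
  window = window-length n p p<n
  -- The codes also agree at p + 1: by hypothesis, or because both tails are empty.
  next-codes : code₃ σ (suc p) ≡ codeHat ω (suc p)
  next-codes with suc p <? n ∸ 1
  ... | yes sp<n = codes (suc p) sp<n
  ... | no  sp≮n = trans (countFrom-empty _ _ (beyond-end n (suc p) sp≮n))
                         (sym (countFrom-empty _ _ (beyond-end n (suc p) sp≮n)))
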